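{- For every $d\ge 1$, the number of elements of the Mockingbird lattice $\mathrm{M}(d)$ is $\mathbf{a}(d-1)$, where $\mathbf{a}(0)=1$ and $\mathbf{a}(n) = \mathbf{a}(n-1) + \mathbf{a}(n-1)^2$ for $n\ge 1$.
   Context: Terms over $\{{\rm M}\}$: the smallest set containing variables $\mathsf{x}_1,\mathsf{x}_2,\dots$, the symbol ${\rm M}$, and $(\mathfrak{t}_1\mathfrak{t}_2)$ for terms $\mathfrak{t}_1,\mathfrak{t}_2$ (application associates to the left). $\Rightarrow$ is the smallest relation with ${\rm M}\,\mathfrak{s}\Rightarrow\mathfrak{s}\,\mathfrak{s}$ for all terms $\mathfrak{s}$, closed under $\mathfrak{t}_1\Rightarrow\mathfrak{t}_1'$ implies $\mathfrak{t}_1\mathfrak{t}_2\Rightarrow\mathfrak{t}_1'\mathfrak{t}_2$ and $\mathfrak{t}_2\mathfrak{t}_1\Rightarrow\mathfrak{t}_2\mathfrak{t}_1'$; $\preccurlyeq$ is its reflexive-transitive closure (a partial order). With $\mathfrak{r}_0={\rm M}$ and $\mathfrak{r}_d = {\rm M}\,\mathfrak{r}_{d-1}$, the Mockingbird lattice $\mathrm{M}(d)$ is the set $\{\mathfrak{t} : \mathfrak{r}_d\preccurlyeq\mathfrak{t}\}$ ordered by $\preccurlyeq$. -}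

module Defs where

open import Data.Nat using (ℕ; zero; suc; _+_; _*_)
open import Data.List using (List; length)
open import Data.List.Membership.Propositional using (_∈_)
open import Data.List.Relation.Unary.Unique.Propositional using (Unique)
open import Data.Product using (Σ; _×_)
open import Relation.Binary.PropositionalEquality using (_≡_)
open import Function.Bundles using (_⇔_)
open import Relation.Binary.Construct.Closure.ReflexiveTransitive using (Star)

data Term : Set where
  var : ℕ → Term
  M   : Term
  _·_ : Term → Term → Term

infixl 9 _·_

data _⇒_ : Term → Term → Set where
  mock  : ∀ s → (M · s) ⇒ (s · s)
  left  : ∀ {t₁ t₁′} t₂ → t₁ ⇒ t₁′ → (t₁ · t₂) ⇒ (t₁′ · t₂)
  right : ∀ {t₁ t₁′} t₂ → t₁ ⇒ t₁′ → (t₂ · t₁) ⇒ (t₂ · t₁′)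

_≼_ : Term → Term → Set
_≼_ = Star _⇒_

r : ℕ → Term
r zero    = M
r (suc d) = M · r d

a : ℕ → ℕ
a zero    = 1
a (suc n) = a n + a n * a n

InM : ℕ → Term → Set
InM d t = r d ≼ t

HasCard : (Term → Set) → ℕ → Set
HasCard P n = Σ (List Term) λ xs → Unique xs × (∀ t → (t ∈ xs) ⇔ P t) × (length xs ≡ n)

-- Along any reduction from M s the term keeps the shape M t or t₁ t₂ with t, t₁, t₂ above s
-- (rewriting under M or on either side preserves it, and M t ⇒ t t turns the first shape into
-- the second), so ↑(M s) = M ↑s ∪ ↑s ↑s.  When s is an application nothing above s is M, the
-- union is disjoint and |↑(M s)| = n + n² for n = |↑s|; with ↑(M M) = {M M} this is the
-- recursion defining a.
module Submission where

open import Defs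
open import Data.Nat using (ℕ; zero; suc; _+_; _*_)
open import Data.List using (List; []; _∷_; [_]; _++_; map; length; cartesianProductWith)
open import Data.List.Properties using (length-map; length-++)
open import Data.List.Membership.Propositional using (_∈_; _∉_)
open import Data.List.Membership.Propositional.Properties
  using (∈-map⁺; ∈-map⁻; ∈-++⁺ˡ; ∈-++⁺ʳ; ∈-++⁻; ∈-cartesianProductWith⁺; ∈-cartesianProductWith⁻)
open import Data.List.Relation.Unary.Any using (here)
open import Data.List.Relation.Unary.All using ([])
open import Data.List.Relation.Unary.AllPairs using ([]; _∷_)
open import Data.List.Relation.Unary.Unique.Propositional using (Unique)
open import Data.List.Relation.Unary.Unique.Propositional.Properties
  using (++⁺; map⁺; cartesianProductWith⁺)
open import Data.Product using (_×_; _,_; ∃₂)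
open import Data.Sum using (inj₁; inj₂)
open import Data.Empty using (⊥-elim)
open import Relation.Nullary using (¬_)
open import Relation.Binary.PropositionalEquality using (_≡_; refl; trans; cong; cong₂)
open import Function.Bundles using (_⇔_; mk⇔; Equivalence)
open import Relation.Binary.Construct.Closure.ReflexiveTransitive using (ε; _◅_; _◅◅_; gmap)

private
  variable
    s t u : Term

M-irreducible : ¬ (M ⇒ u)
M-irreducible ()

M-upset : M ≼ t → t ≡ M
M-upset ε = refl

⇒-app : s ⇒ u → ∃₂ λ u₁ u₂ → u ≡ u₁ · u₂
⇒-app (mock _)    = _ , _ , refl
⇒-app (left _ _)  = _ , _ , refl
⇒-app (right _ _) = _ , _ , refl

·-upset-app : ∀ {s₁ s₂} → (s₁ · s₂) ≼ u → ∃₂ λ u₁ u₂ → u ≡ u₁ · u₂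
·-upset-app ε = _ , _ , refl
·-upset-app (step ◅ steps) with ⇒-app step
... | _ , _ , refl = ·-upset-app steps

·⋠M : ∀ {s₁ s₂} → ¬ ((s₁ · s₂) ≼ M)
·⋠M q with ·-upset-app q
... | _ , _ , ()

data M·Upset (s : Term) : Term → Set where
  under-M : ∀ {t}     → s ≼ t  → M·Upset s (M · t)
  both    : ∀ {t₁ t₂} → s ≼ t₁ → s ≼ t₂ → M·Upset s (t₁ · t₂)

M·Upset-step : M·Upset s t → t ⇒ u → M·Upset s u
M·Upset-step (under-M p) (mock _)    = both p p
M·Upset-step (under-M p) (left _ x)  = ⊥-elim (M-irreducible x)
M·Upset-step (under-M p) (right _ x) = under-M (p ◅◅ x ◅ ε)
-- Here t₁ = M, so the head M fires inside the set and no hypothesis on s is needed.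
M·Upset-step (both p q)  (mock _)    = both q q
M·Upset-step (both p q)  (left _ x)  = both (p ◅◅ x ◅ ε) q
M·Upset-step (both p q)  (right _ x) = both p (q ◅◅ x ◅ ε)

M·Upset-star : M·Upset s t → t ≼ u → M·Upset s u
M·Upset-star c ε              = c
M·Upset-star c (step ◅ steps) = M·Upset-star (M·Upset-step c step) steps

M·Upset-sound : M·Upset s t → (M · s) ≼ t
M·Upset-sound (under-M p) = gmap (M ·_) (right M) p
M·Upset-sound {s} (both {t₁} p q) =
  mock s ◅ gmap (_· s) (left s) p ◅◅ gmap (t₁ ·_) (right t₁) q

M·-upset : ((M · s) ≼ t) ⇔ M·Upset s t
M·-upset = mk⇔ (M·Upset-star (under-M ε)) M·Upset-sound

M·M-upset : (M · M) ≼ t → t ≡ M · M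
M·M-upset q with Equivalence.to M·-upset q
... | under-M p = cong (M ·_) (M-upset p)
... | both p₁ p₂ = cong₂ _·_ (M-upset p₁) (M-upset p₂)

M·-injective : ∀ {t₁ t₂} → M · t₁ ≡ M · t₂ → t₁ ≡ t₂
M·-injective refl = refl

·-injective : ∀ {s₁ s₂ t₁ t₂} → s₁ · t₁ ≡ s₂ · t₂ → s₁ ≡ s₂ × t₁ ≡ t₂
·-injective refl = refl , refl

length-cartesianProductWith : ∀ {A B C : Set} (f : A → B → C) xs ys →
  length (cartesianProductWith f xs ys) ≡ length xs * length ys
length-cartesianProductWith f []       ys = refl
length-cartesianProductWith f (x ∷ xs) ys =
  trans (length-++ (map (f x) ys))
        (cong₂ _+_ (length-map (f x) ys) (length-cartesianProductWith f xs ys))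

M·-enumeration : List Term → List Term
M·-enumeration xs = map (M ·_) xs ++ cartesianProductWith _·_ xs xs

∈-M·-enumeration : ∀ {xs} → (∀ t → (t ∈ xs) ⇔ (s ≼ t)) →
                   ∀ t → (t ∈ M·-enumeration xs) ⇔ ((M · s) ≼ t)
∈-M·-enumeration {s} {xs} ∈xs⇔ t = mk⇔ to from
  where
  to : t ∈ M·-enumeration xs → (M · s) ≼ t
  to m with ∈-++⁻ (map (M ·_) xs) m
  ... | inj₁ m′ with ∈-map⁻ (M ·_) m′
  ...   | _ , m₁ , refl = M·Upset-sound (under-M (Equivalence.to (∈xs⇔ _) m₁))
  to m | inj₂ m′ with ∈-cartesianProductWith⁻ _·_ xs xs m′
  ...   | _ , _ , m₁ , m₂ , refl =
          M·Upset-sound (both (Equivalence.to (∈xs⇔ _) m₁) (Equivalence.to (∈xs⇔ _) m₂))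
  from : (M · s) ≼ t → t ∈ M·-enumeration xs
  from q with Equivalence.to M·-upset q
  ... | under-M p = ∈-++⁺ˡ (∈-map⁺ (M ·_) (Equivalence.from (∈xs⇔ _) p))
  ... | both p₁ p₂ = ∈-++⁺ʳ (map (M ·_) xs)
          (∈-cartesianProductWith⁺ _·_ (Equivalence.from (∈xs⇔ _) p₁) (Equivalence.from (∈xs⇔ _) p₂))

M·-enumeration-unique : ∀ {xs} → M ∉ xs → Unique xs → Unique (M·-enumeration xs)
M·-enumeration-unique {xs} M∉xs uxs =
  ++⁺ (map⁺ M·-injective uxs) (cartesianProductWith⁺ _·_ ·-injective uxs uxs) disjoint
  where
  disjoint : ∀ {v} → ¬ (v ∈ map (M ·_) xs × v ∈ cartesianProductWith _·_ xs xs)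
  disjoint (m₁ , m₂) with ∈-map⁻ (M ·_) m₁ | ∈-cartesianProductWith⁻ _·_ xs xs m₂
  ... | _ , _ , refl | _ , _ , M∈xs , _ , refl = M∉xs M∈xs

length-M·-enumeration : ∀ xs → length (M·-enumeration xs) ≡ length xs + length xs * length xs
length-M·-enumeration xs =
  trans (length-++ (map (M ·_) xs))
        (cong₂ _+_ (length-map (M ·_) xs) (length-cartesianProductWith _·_ xs xs))

HasCard-M·M : HasCard ((M · M) ≼_) 1
HasCard-M·M = [ M · M ] , [] ∷ [] , ∈⇔ , refl
  where
  ∈⇔ : ∀ t → (t ∈ [ M · M ]) ⇔ ((M · M) ≼ t)
  ∈⇔ t = mk⇔ (λ { (here refl) → ε }) (λ q → here (M·M-upset q))

HasCard-M· : ∀ {n} → ¬ (s ≼ M) → HasCard (s ≼_) n → HasCard ((M · s) ≼_) (n + n * n)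
HasCard-M· s⋠M (xs , uxs , ∈xs⇔ , refl) =
  M·-enumeration xs ,
  M·-enumeration-unique (λ M∈xs → s⋠M (Equivalence.to (∈xs⇔ M) M∈xs)) uxs ,
  ∈-M·-enumeration ∈xs⇔ ,
  length-M·-enumeration xs

mainTheorem13 : (d : ℕ) → HasCard (InM (suc d)) (a d)
mainTheorem13 zero    = HasCard-M·M
mainTheorem13 (suc d) = HasCard-M· ·⋠M (mainTheorem13 d)
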